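{- Let $1\le\ell\le d\le n/2$. Any adaptive deterministic group testing algorithm that is given $n,\ell$ and the exact value of $d$ and that, for every defective set $I\subseteq[n]$ with $|I|=d$, outputs a set $L\subseteq I$ with $|L|=\ell$, must make (on some such input) at least $\max(\ell\log(n/d),\log n-1)=\Omega(\ell\log(n/d)+\log n)$ tests.
   Context: Group testing model: the items are $[n]=\{1,\dots,n\}$ and there is an unknown set $I\subseteq[n]$ of defective items, $d=|I|$. A test is a subset $Q\subseteq[n]$, and its answer is $T_I(Q)=1$ if $Q\cap I\neq\emptyset$ and $T_I(Q)=0$ otherwise; the algorithm accesses $I$ only through test answers. An adaptive algorithm may choose each test depending on the answers to previous tests. All logarithms are base 2. -}

module Defs where

open import Data.Bool using (Bool; true; false; not)
open import Data.Nat using (ℕ; zero; suc; _≡ᵇ_)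
open import Data.Fin.Subset using (Subset; _∩_; ∣_∣)
open import Data.Product using (_×_; _,_)

testAnswer : ∀ {n} → Subset n → Subset n → Bool
testAnswer Q I = not (∣ Q ∩ I ∣ ≡ᵇ 0)

-- An adaptive deterministic group testing algorithm on items Fin n,
-- as a (finite) decision tree: either output a set, or perform a
-- test Q and continue with the subtree chosen by the answer
-- (first branch: answer 0, second branch: answer 1).
data Alg (n : ℕ) : Set where
  output : Subset n → Alg n
  test   : Subset n → Alg n → Alg n → Alg n

result : ∀ {n} → Alg n → Subset n → Subset n
result (output L) I = L
result (test Q a0 a1) I with testAnswer Q I
... | false = result a0 I
... | true  = result a1 I

numTests : ∀ {n} → Alg n → Subset n → ℕ
numTests (output L) I = 0
numTests (test Q a0 a1) I with testAnswer Q I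
... | false = suc (numTests a0 I)
... | true  = suc (numTests a1 I)

{-# OPTIONS --safe #-}
-- Let t be the largest number of tests A makes on a d-set, and I a d-set attaining it.
-- Unfolding the decision tree to depth t shows that A has at most 2^t possible outputs
-- on d-sets.  Every d-set contains its output, an ℓ-set, and an ℓ-set lies in only
-- C(n-ℓ,d-ℓ) of the d-sets, so C(n,d) ≤ 2^t C(n-ℓ,d-ℓ); as C(n,d)/C(n-ℓ,d-ℓ) is the
-- product of the ratios (n-i)/(d-i) ≥ n/d for i < ℓ, this gives n^ℓ ≤ 2^t d^ℓ.
-- If n > 2^(t+1), pick one element from each of the at most 2^t ≤ n/2 outputs; since
-- d ≤ n/2 some d-set avoids all of them, and its output cannot lie inside it.
module Submission where

open import Defs
open import Data.Nat using (ℕ; zero; suc; _+_; _*_; _^_; _∸_; _⊔_; _≤_; _<_; z≤n; s≤s; >-nonZero)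
open import Data.Nat.Properties
open import Data.Nat.Combinatorics using (_C_; nC1≡n; nCk+nC[k+1]≡[n+1]C[k+1])
open import Data.Bool using (true; false)
open import Data.Vec using ([]; _∷_)
open import Data.Fin.Subset
  using (Subset; _⊆_; _∪_; _∩_; ∁; ⊥; ⊤; ⁅_⁆; ∣_∣; Nonempty; Empty; inside; outside)
open import Data.Fin.Subset.Properties
  using ( _⊆?_; out⊆-⇔; in⊆in-⇔; s⊆s; p⊆q⇒∣p∣≤∣q∣; ∣p∣≤n; ∣p∣≤∣x∷p∣; ∣⊥∣≡0; ∣⊤∣≡n; ∉⊥; Empty-unique
        ; ∣⁅x⁆∣≡1; x∈⁅x⁆; p⊆p∪q; q⊆p∪q; x∈p∩q⁺; x∈p∩q⁻; nonempty?; x∈∁p⇒x∉p; ∣∁p∣≡n∸∣p∣)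
open import Data.List using (List; []; _∷_; [_]; map; _++_; length; filter)
open import Data.List.Properties using (length-map; length-++; length-filter; filter-++; filter-none)
open import Data.List.Membership.Propositional using (_∈_; lose)
open import Data.List.Membership.Propositional.Properties using (∈-map⁺; ∈-++⁺ˡ; ∈-++⁺ʳ; ∈-filter⁺)
open import Data.List.Relation.Unary.Any as Any using (Any; here)
open import Data.List.Relation.Unary.All as All using (All; []; _∷_)
open import Data.List.Relation.Unary.All.Properties using (map⁺; ++⁺; all-filter; filter⁺)
open import Data.List.Relation.Binary.Sublist.Propositional.Properties as Sublist
  using (filter-⊆; length-mono-≤)
open import Data.List.Extrema.Nat using (argmax; argmax-all; f[xs]≤f[argmax])
open import Data.Product using (Σ; ∃; _×_; _,_)
open import Function.Bundles using (_⇔_; Equivalence)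
open import Relation.Nullary using (yes; no; ¬_; contradiction)
open import Relation.Unary using (Pred; Decidable)
open import Relation.Unary.Properties using (∁?)
open import Relation.Binary.PropositionalEquality
  using (_≡_; refl; sym; trans; cong; cong₂; subst; subst₂; module ≡-Reasoning)

private
  variable
    n : ℕ

nCk≤[1+n]C[1+k] : ∀ n k → n C k ≤ suc n C suc k
nCk≤[1+n]C[1+k] n k = ≤-trans (m≤m+n (n C k) _) (≤-reflexive (nCk+nC[k+1]≡[n+1]C[k+1] n k))

0<nCk : ∀ {n k} → k ≤ n → 0 < n C k
0<nCk {n}     {zero}  _         = s≤s z≤n
0<nCk {suc n} {suc k} (s≤s k≤n) =
  ≤-trans (0<nCk k≤n) (nCk≤[1+n]C[1+k] n k)

nCk≤[1+n]Ck : ∀ n k → n C k ≤ suc n C k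
nCk≤[1+n]Ck n zero    = ≤-refl
nCk≤[1+n]Ck n (suc k) = ≤-trans (m≤n+m (n C suc k) (n C k)) (≤-reflexive (nCk+nC[k+1]≡[n+1]C[k+1] n k))

[1+k]*[1+n]C[1+k]≡[1+n]*nCk : ∀ n k → suc k * (suc n C suc k) ≡ suc n * (n C k)
[1+k]*[1+n]C[1+k]≡[1+n]*nCk zero    zero    = refl
[1+k]*[1+n]C[1+k]≡[1+n]*nCk zero    (suc k) = *-zeroʳ (suc (suc k))
[1+k]*[1+n]C[1+k]≡[1+n]*nCk (suc n) zero    = begin
  1 * (suc (suc n) C 1) ≡⟨ *-identityˡ _ ⟩
  suc (suc n) C 1       ≡⟨ nC1≡n (suc (suc n)) ⟩
  suc (suc n)           ≡⟨ *-identityʳ (suc (suc n)) ⟨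
  suc (suc n) * 1       ∎
  where open ≡-Reasoning
[1+k]*[1+n]C[1+k]≡[1+n]*nCk (suc n) (suc k) = begin
  (2 + k) * ((2 + n) C (2 + k))
    ≡⟨ cong ((2 + k) *_) (nCk+nC[k+1]≡[n+1]C[k+1] (suc n) (suc k)) ⟨
  (2 + k) * (X + suc n C (2 + k))
    ≡⟨ *-distribˡ-+ (2 + k) X _ ⟩
  (X + (1 + k) * X) + (2 + k) * (suc n C (2 + k))
    ≡⟨ cong₂ (λ a b → (X + a) + b) ([1+k]*[1+n]C[1+k]≡[1+n]*nCk n k) ([1+k]*[1+n]C[1+k]≡[1+n]*nCk n (suc k)) ⟩
  (X + suc n * (n C k)) + suc n * (n C suc k)
    ≡⟨ +-assoc X _ _ ⟩
  X + (suc n * (n C k) + suc n * (n C suc k))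
    ≡⟨ cong (X +_) (*-distribˡ-+ (suc n) (n C k) _) ⟨
  X + suc n * (n C k + n C suc k)
    ≡⟨ cong (λ y → X + suc n * y) (nCk+nC[k+1]≡[n+1]C[k+1] n k) ⟩
  (2 + n) * X ∎
  where
  open ≡-Reasoning
  X = suc n C suc k

[n+l]^l*nCk≤[k+l]^l*[n+l]C[k+l] : ∀ l n k → (n + l) ^ l * (n C k) ≤ (k + l) ^ l * ((n + l) C (k + l))
[n+l]^l*nCk≤[k+l]^l*[n+l]C[k+l] zero n k rewrite +-identityʳ n | +-identityʳ k = ≤-refl
[n+l]^l*nCk≤[k+l]^l*[n+l]C[k+l] (suc l) n k rewrite +-suc n l | +-suc k l = begin
  N ^ suc l * (n C k)              ≡⟨ *-assoc N (N ^ l) (n C k) ⟩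
  N * (N ^ l * (n C k))            ≡⟨ x∙yz≈y∙xz N (N ^ l) (n C k) ⟩
  N ^ l * (N * (n C k))            ≤⟨ *-monoʳ-≤ (N ^ l) one-step ⟩
  N ^ l * (K * (suc n C suc k))    ≡⟨ x∙yz≈y∙xz (N ^ l) K _ ⟩
  K * (N ^ l * (suc n C suc k))    ≤⟨ *-monoʳ-≤ K ([n+l]^l*nCk≤[k+l]^l*[n+l]C[k+l] l (suc n) (suc k)) ⟩
  K * (K ^ l * (N C K))            ≡⟨ *-assoc K (K ^ l) _ ⟨
  K ^ suc l * (N C K)              ∎
  where
  open ≤-Reasoning
  open import Algebra.Properties.CommutativeSemigroup *-commutativeSemigroup using (x∙yz≈y∙xz)
  N = suc n + l
  K = suc k + l
  one-step : N * (n C k) ≤ K * (suc n C suc k)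
  one-step = begin
    (suc n + l) * (n C k)                  ≡⟨ *-distribʳ-+ (n C k) (suc n) l ⟩
    suc n * (n C k) + l * (n C k)          ≡⟨ cong (_+ l * (n C k)) ([1+k]*[1+n]C[1+k]≡[1+n]*nCk n k) ⟨
    suc k * (suc n C suc k) + l * (n C k)  ≤⟨ +-monoʳ-≤ _ (*-monoʳ-≤ l (nCk≤[1+n]C[1+k] n k)) ⟩
    suc k * (suc n C suc k) + l * (suc n C suc k) ≡⟨ *-distribʳ-+ (suc n C suc k) (suc k) l ⟨
    (suc k + l) * (suc n C suc k)          ∎

n^l*[n∸l]C[d∸l]≤d^l*nCd : ∀ {n d l} → l ≤ d → d ≤ n → n ^ l * ((n ∸ l) C (d ∸ l)) ≤ d ^ l * (n C d)
n^l*[n∸l]C[d∸l]≤d^l*nCd {n} {d} {l} l≤d d≤n =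
  subst₂ (λ a b → a ^ l * ((n ∸ l) C (d ∸ l)) ≤ b ^ l * (a C b))
         (m∸n+n≡m (≤-trans l≤d d≤n)) (m∸n+n≡m l≤d)
         ([n+l]^l*nCk≤[k+l]^l*[n+l]C[k+l] l (n ∸ l) (d ∸ l))

2*m≤o⇒2*n≤o⇒m+n≤o : ∀ {m n o} → 2 * m ≤ o → 2 * n ≤ o → m + n ≤ o
2*m≤o⇒2*n≤o⇒m+n≤o {m} {n} {o} 2m≤o 2n≤o = begin
  m + n                 ≤⟨ +-mono-≤ (m≤m⊔n m n) (m≤n⊔m m n) ⟩
  (m ⊔ n) + (m ⊔ n)     ≡⟨ cong ((m ⊔ n) +_) (+-identityʳ (m ⊔ n)) ⟨
  2 * (m ⊔ n)           ≡⟨ *-distribˡ-⊔ 2 m n ⟩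
  (2 * m) ⊔ (2 * n)     ≤⟨ ⊔-lub 2m≤o 2n≤o ⟩
  o                     ∎
  where open ≤-Reasoning

length-filter+length-filter-∁ : ∀ {a p} {A : Set a} {P : Pred A p} (P? : Decidable P) xs →
  length (filter P? xs) + length (filter (∁? P?) xs) ≡ length xs
length-filter+length-filter-∁ P? [] = refl
length-filter+length-filter-∁ P? (x ∷ xs) with P? x
... | yes _ = cong suc (length-filter+length-filter-∁ P? xs)
... | no  _ = trans (+-suc _ _) (cong suc (length-filter+length-filter-∁ P? xs))

length≤length*fibre : ∀ {a b r} {A : Set a} {B : Set b} {R : B → A → Set r}
  (R? : ∀ y → Decidable (R y)) {K} (xs : List A) (ys : List B) →
  All (λ x → Any (λ y → R y x) ys) xs → All (λ y → length (filter (R? y) xs) ≤ K) ys →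
  length xs ≤ length ys * K
length≤length*fibre R? []      ys       _          _               = z≤n
length≤length*fibre R? (_ ∷ _) []       (() ∷ _)   _
length≤length*fibre {R = R} R? {K} xs (y ∷ ys) covered (fibre ∷ fibres) = begin
  length xs
    ≡⟨ length-filter+length-filter-∁ (R? y) xs ⟨
  length (filter (R? y) xs) + length rest
    ≤⟨ +-mono-≤ fibre (length≤length*fibre R? rest ys covered′ fibres′) ⟩
  K + length ys * K ∎
  where
  open ≤-Reasoning
  rest = filter (∁? (R? y)) xs
  covered′ : All (λ x → Any (λ y → R y x) ys) rest
  covered′ = All.zipWith (λ (¬Ryx , any) → Any.tail ¬Ryx any)
                         (all-filter (∁? (R? y)) xs , filter⁺ (∁? (R? y)) covered)
  fibres′ : All (λ y′ → length (filter (R? y′) rest) ≤ K) ys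
  fibres′ = All.map (λ {y′} → ≤-trans (length-mono-≤
    (Sublist.filter⁺ (R? y′) (R? y′) (λ { refl r → r }) (filter-⊆ (∁? (R? y)) xs)))) fibres

length-filter-map : ∀ {a b p q} {A : Set a} {B : Set b} {P : Pred A p} {Q : Pred B q}
  (f : B → A) (P? : Decidable P) (Q? : Decidable Q) →
  (∀ {x} → Q x ⇔ P (f x)) → ∀ xs → length (filter P? (map f xs)) ≡ length (filter Q? xs)
length-filter-map f P? Q? Q⇔P∘f [] = refl
length-filter-map f P? Q? Q⇔P∘f (x ∷ xs) with P? (f x) | Q? x
... | yes _  | yes _  = cong suc (length-filter-map f P? Q? Q⇔P∘f xs)
... | no _   | no _   = length-filter-map f P? Q? Q⇔P∘f xs
... | yes px | no ¬qx = contradiction (Equivalence.from Q⇔P∘f px) ¬qx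
... | no ¬px | yes qx = contradiction (Equivalence.to Q⇔P∘f qx) ¬px

length-filter-++ : ∀ {a p} {A : Set a} {P : Pred A p} (P? : Decidable P) xs ys →
  length (filter P? (xs ++ ys)) ≡ length (filter P? xs) + length (filter P? ys)
length-filter-++ P? xs ys = trans (cong length (filter-++ P? xs ys)) (length-++ (filter P? xs))

∣p∪q∣≤∣p∣+∣q∣ : (p q : Subset n) → ∣ p ∪ q ∣ ≤ ∣ p ∣ + ∣ q ∣
∣p∪q∣≤∣p∣+∣q∣ []            []            = z≤n
∣p∪q∣≤∣p∣+∣q∣ (inside ∷ p)  (s ∷ q)       =
  s≤s (≤-trans (∣p∪q∣≤∣p∣+∣q∣ p q) (+-monoʳ-≤ ∣ p ∣ (∣p∣≤∣x∷p∣ s q)))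
∣p∪q∣≤∣p∣+∣q∣ (outside ∷ p) (inside ∷ q)  =
  ≤-trans (s≤s (∣p∪q∣≤∣p∣+∣q∣ p q)) (≤-reflexive (sym (+-suc ∣ p ∣ ∣ q ∣)))
∣p∪q∣≤∣p∣+∣q∣ (outside ∷ p) (outside ∷ q) = ∣p∪q∣≤∣p∣+∣q∣ p q

subset-of-size : ∀ {d} (p : Subset n) → d ≤ ∣ p ∣ → ∃ λ q → q ⊆ p × ∣ q ∣ ≡ d
subset-of-size {n} {zero} p _ = ⊥ , (λ x∈⊥ → contradiction x∈⊥ ∉⊥) , ∣⊥∣≡0 n
subset-of-size {d = suc d} (inside ∷ p) (s≤s d≤∣p∣) with subset-of-size p d≤∣p∣
... | q , q⊆p , ∣q∣≡d = inside ∷ q , s⊆s q⊆p , cong suc ∣q∣≡d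
subset-of-size {d = suc d} (outside ∷ p) d<∣p∣ with subset-of-size p d<∣p∣
... | q , q⊆p , ∣q∣≡d = outside ∷ q , s⊆s q⊆p , ∣q∣≡d

hitting-set : (Ls : List (Subset n)) →
  ∃ λ H → ∣ H ∣ ≤ length Ls × All (λ L → Nonempty L → Nonempty (L ∩ H)) Ls
hitting-set {n} []   = ⊥ , ≤-reflexive (∣⊥∣≡0 n) , []
hitting-set (L ∷ Ls) with hitting-set Ls | nonempty? L
... | H , ∣H∣≤∣Ls∣ , hits | no ¬nonempty =
  H , m≤n⇒m≤1+n ∣H∣≤∣Ls∣ , (λ nonempty → contradiction nonempty ¬nonempty) ∷ hits
... | H , ∣H∣≤∣Ls∣ , hits | yes (x , x∈L) =
  ⁅ x ⁆ ∪ H , ∣H′∣≤1+∣Ls∣ , (λ _ → x , x∈p∩q⁺ (x∈L , p⊆p∪q H (x∈⁅x⁆ x))) ∷ All.map widen hits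
  where
  ∣H′∣≤1+∣Ls∣ : ∣ ⁅ x ⁆ ∪ H ∣ ≤ suc (length Ls)
  ∣H′∣≤1+∣Ls∣ = ≤-trans (∣p∪q∣≤∣p∣+∣q∣ ⁅ x ⁆ H)
                       (≤-trans (≤-reflexive (cong (_+ ∣ H ∣) (∣⁅x⁆∣≡1 x))) (s≤s ∣H∣≤∣Ls∣))
  widen : ∀ {L′} → (Nonempty L′ → Nonempty (L′ ∩ H)) → Nonempty L′ → Nonempty (L′ ∩ (⁅ x ⁆ ∪ H))
  widen hit nonempty with hit nonempty
  ... | y , y∈L′∩H with x∈p∩q⁻ _ _ y∈L′∩H
  ...   | y∈L′ , y∈H = y , x∈p∩q⁺ (y∈L′ , q⊆p∪q ⁅ x ⁆ H y∈H)

avoiding-subset : ∀ d (Ls : List (Subset n)) → d + length Ls ≤ n →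
  ∃ λ I → ∣ I ∣ ≡ d × All (λ L → L ⊆ I → Empty L) Ls
avoiding-subset {n} d Ls d+∣Ls∣≤n with hitting-set Ls
... | H , ∣H∣≤∣Ls∣ , hits with subset-of-size (∁ H) d≤∣∁H∣
  where
  d≤∣∁H∣ : d ≤ ∣ ∁ H ∣
  d≤∣∁H∣ = ≤-trans (m+n≤o⇒m≤o∸n d d+∣Ls∣≤n)
                   (≤-trans (∸-monoʳ-≤ n ∣H∣≤∣Ls∣) (≤-reflexive (sym (∣∁p∣≡n∸∣p∣ H))))
... | I , I⊆∁H , ∣I∣≡d = I , ∣I∣≡d , All.map avoids hits
  where
  avoids : ∀ {L} → (Nonempty L → Nonempty (L ∩ H)) → L ⊆ I → Empty L
  avoids hit L⊆I nonempty with hit nonempty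
  ... | x , x∈L∩H with x∈p∩q⁻ _ _ x∈L∩H
  ...   | x∈L , x∈H = x∈∁p⇒x∉p (I⊆∁H (L⊆I x∈L)) x∈H

Empty⇒∣p∣≡0 : {p : Subset n} → Empty p → ∣ p ∣ ≡ 0
Empty⇒∣p∣≡0 {n} empty = trans (cong ∣_∣ (Empty-unique empty)) (∣⊥∣≡0 n)

subsets : (n d : ℕ) → List (Subset n)
subsets zero    zero    = [ [] ]
subsets zero    (suc d) = []
subsets (suc n) zero    = map (outside ∷_) (subsets n zero)
subsets (suc n) (suc d) = map (inside ∷_) (subsets n d) ++ map (outside ∷_) (subsets n (suc d))

subsets-sizes : ∀ n d → All (λ I → ∣ I ∣ ≡ d) (subsets n d)
subsets-sizes zero    zero    = refl ∷ []
subsets-sizes zero    (suc d) = []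
subsets-sizes (suc n) zero    = map⁺ (subsets-sizes n zero)
subsets-sizes (suc n) (suc d) =
  ++⁺ (map⁺ (All.map (cong suc) (subsets-sizes n d))) (map⁺ (subsets-sizes n (suc d)))

∈-subsets : (I : Subset n) → I ∈ subsets n ∣ I ∣
∈-subsets []           = here refl
∈-subsets (inside ∷ I) = ∈-++⁺ˡ (∈-map⁺ (inside ∷_) (∈-subsets I))
∈-subsets (outside ∷ I) with ∣ I ∣ | ∈-subsets I
... | zero  | I∈ = ∈-map⁺ (outside ∷_) I∈
... | suc d | I∈ = ∈-++⁺ʳ (map (inside ∷_) (subsets _ d)) (∈-map⁺ (outside ∷_) I∈)

length-subsets : ∀ n d → length (subsets n d) ≡ n C d
length-subsets zero    zero    = refl
length-subsets zero    (suc d) = refl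
length-subsets (suc n) zero    = trans (length-map (outside ∷_) (subsets n zero)) (length-subsets n zero)
length-subsets (suc n) (suc d) = begin
  length (map (inside ∷_) (subsets n d) ++ map (outside ∷_) (subsets n (suc d)))
    ≡⟨ length-++ (map (inside ∷_) (subsets n d)) ⟩
  length (map (inside ∷_) (subsets n d)) + length (map (outside ∷_) (subsets n (suc d)))
    ≡⟨ cong₂ _+_ (length-map (inside ∷_) (subsets n d)) (length-map (outside ∷_) (subsets n (suc d))) ⟩
  length (subsets n d) + length (subsets n (suc d))
    ≡⟨ cong₂ _+_ (length-subsets n d) (length-subsets n (suc d)) ⟩
  n C d + n C suc d
    ≡⟨ nCk+nC[k+1]≡[n+1]C[k+1] n d ⟩
  suc n C suc d ∎
  where open ≡-Reasoning

filter-⊆?-subsets-< : ∀ {n d} (L : Subset n) → d < ∣ L ∣ → filter (L ⊆?_) (subsets n d) ≡ []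
filter-⊆?-subsets-< {n} {d} L d<∣L∣ = filter-none (L ⊆?_) (All.map L⊈ (subsets-sizes n d))
  where
  L⊈ : ∀ {I} → ∣ I ∣ ≡ d → ¬ L ⊆ I
  L⊈ refl L⊆I = <⇒≱ d<∣L∣ (p⊆q⇒∣p∣≤∣q∣ L⊆I)

filter-in∷⊆?-map-out∷ : ∀ (L : Subset n) xs → filter ((inside ∷ L) ⊆?_) (map (outside ∷_) xs) ≡ []
filter-in∷⊆?-map-out∷ L []       = refl
filter-in∷⊆?-map-out∷ L (I ∷ xs) = filter-in∷⊆?-map-out∷ L xs

length-filter-in∷⊆?-subsets : ∀ (L : Subset n) d →
  length (filter ((inside ∷ L) ⊆?_) (subsets (suc n) (suc d))) ≡ length (filter (L ⊆?_) (subsets n d))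
length-filter-in∷⊆?-subsets {n} L d = begin
  length (filter ((inside ∷ L) ⊆?_) (map (inside ∷_) (subsets n d) ++ map (outside ∷_) (subsets n (suc d))))
    ≡⟨ length-filter-++ ((inside ∷ L) ⊆?_) (map (inside ∷_) (subsets n d)) _ ⟩
  length (filter ((inside ∷ L) ⊆?_) (map (inside ∷_) (subsets n d)))
    + length (filter ((inside ∷ L) ⊆?_) (map (outside ∷_) (subsets n (suc d))))
    ≡⟨ cong₂ _+_ (length-filter-map (inside ∷_) _ (L ⊆?_) in⊆in-⇔ (subsets n d))
                 (cong length (filter-in∷⊆?-map-out∷ L (subsets n (suc d)))) ⟩
  length (filter (L ⊆?_) (subsets n d)) + 0
    ≡⟨ +-identityʳ _ ⟩
  length (filter (L ⊆?_) (subsets n d)) ∎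
  where open ≡-Reasoning

length-filter-out∷⊆?-subsets : ∀ (L : Subset n) d →
  length (filter ((outside ∷ L) ⊆?_) (subsets (suc n) (suc d)))
    ≡ length (filter (L ⊆?_) (subsets n d)) + length (filter (L ⊆?_) (subsets n (suc d)))
length-filter-out∷⊆?-subsets {n} L d = trans
  (length-filter-++ ((outside ∷ L) ⊆?_) (map (inside ∷_) (subsets n d)) _)
  (cong₂ _+_ (length-filter-map (inside ∷_) _ (L ⊆?_) out⊆-⇔ (subsets n d))
             (length-filter-map (outside ∷_) _ (L ⊆?_) out⊆-⇔ (subsets n (suc d))))

-- Only a bound: for d < ∣ L ∣ the left side is 0, but d ∸ ∣ L ∣ truncates to 0 and the right side is 1.
length-filter-⊆?-subsets : ∀ {n} d (L : Subset n) →
  length (filter (L ⊆?_) (subsets n d)) ≤ (n ∸ ∣ L ∣) C (d ∸ ∣ L ∣)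
length-filter-⊆?-subsets zero    [] = ≤-refl
length-filter-⊆?-subsets (suc d) [] = z≤n
length-filter-⊆?-subsets {suc n} zero (inside ∷ L) =
  ≤-trans (≤-reflexive (cong length (filter-in∷⊆?-map-out∷ L (subsets n zero)))) z≤n
length-filter-⊆?-subsets {suc n} (suc d) (inside ∷ L) =
  ≤-trans (≤-reflexive (length-filter-in∷⊆?-subsets L d)) (length-filter-⊆?-subsets d L)
length-filter-⊆?-subsets {suc n} d (outside ∷ L) =
  subst (λ k → length (filter ((outside ∷ L) ⊆?_) (subsets (suc n) d)) ≤ k C (d ∸ m))
        (sym (+-∸-assoc 1 (∣p∣≤n L))) (bound d)
  where
  open ≤-Reasoning
  m = ∣ L ∣
  bound : ∀ d → length (filter ((outside ∷ L) ⊆?_) (subsets (suc n) d)) ≤ suc (n ∸ m) C (d ∸ m)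
  bound zero = begin
    length (filter ((outside ∷ L) ⊆?_) (map (outside ∷_) (subsets n zero)))
      ≡⟨ length-filter-map (outside ∷_) _ (L ⊆?_) out⊆-⇔ (subsets n zero) ⟩
    length (filter (L ⊆?_) (subsets n zero))
      ≤⟨ length-filter-⊆?-subsets zero L ⟩
    (n ∸ m) C (0 ∸ m)
      ≤⟨ nCk≤[1+n]Ck (n ∸ m) (0 ∸ m) ⟩
    suc (n ∸ m) C (0 ∸ m) ∎
  bound (suc d) with m ≤? d
  ... | yes m≤d = begin
    length (filter ((outside ∷ L) ⊆?_) (subsets (suc n) (suc d)))
      ≡⟨ length-filter-out∷⊆?-subsets L d ⟩
    length (filter (L ⊆?_) (subsets n d)) + length (filter (L ⊆?_) (subsets n (suc d)))
      ≤⟨ +-mono-≤ (length-filter-⊆?-subsets d L) (length-filter-⊆?-subsets (suc d) L) ⟩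
    (n ∸ m) C (d ∸ m) + (n ∸ m) C (suc d ∸ m)
      ≡⟨ cong (λ k → (n ∸ m) C (d ∸ m) + (n ∸ m) C k) (+-∸-assoc 1 m≤d) ⟩
    (n ∸ m) C (d ∸ m) + (n ∸ m) C suc (d ∸ m)
      ≡⟨ nCk+nC[k+1]≡[n+1]C[k+1] (n ∸ m) (d ∸ m) ⟩
    suc (n ∸ m) C suc (d ∸ m)
      ≡⟨ cong (suc (n ∸ m) C_) (+-∸-assoc 1 m≤d) ⟨
    suc (n ∸ m) C (suc d ∸ m) ∎
  ... | no m≰d = begin
    length (filter ((outside ∷ L) ⊆?_) (subsets (suc n) (suc d)))
      ≡⟨ length-filter-out∷⊆?-subsets L d ⟩
    length (filter (L ⊆?_) (subsets n d)) + length (filter (L ⊆?_) (subsets n (suc d)))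
      ≡⟨ cong (λ xs → length xs + length (filter (L ⊆?_) (subsets n (suc d))))
              (filter-⊆?-subsets-< L (≰⇒> m≰d)) ⟩
    length (filter (L ⊆?_) (subsets n (suc d)))
      ≤⟨ length-filter-⊆?-subsets (suc d) L ⟩
    (n ∸ m) C (suc d ∸ m)
      ≤⟨ nCk≤[1+n]Ck (n ∸ m) (suc d ∸ m) ⟩
    suc (n ∸ m) C (suc d ∸ m) ∎

worst-case : ∀ d (f : Subset n → ℕ) → d ≤ n → ∃ λ I → ∣ I ∣ ≡ d × (∀ J → ∣ J ∣ ≡ d → f J ≤ f I)
worst-case {n} d f d≤n with subset-of-size ⊤ (subst (d ≤_) (sym (∣⊤∣≡n n)) d≤n)
... | I₀ , _ , ∣I₀∣≡d =
  argmax f I₀ (subsets n d) , argmax-all f ∣I₀∣≡d (subsets-sizes n d) , dominates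
  where
  dominates : ∀ J → ∣ J ∣ ≡ d → f J ≤ f (argmax f I₀ (subsets n d))
  dominates J refl = All.lookup (f[xs]≤f[argmax] {f = f} I₀ (subsets n ∣ J ∣)) (∈-subsets J)

results-cover : (A : Alg n) (t : ℕ) →
  ∃ λ Ls → length Ls ≤ 2 ^ t × (∀ I → numTests A I ≤ t → result A I ∈ Ls)
results-cover (output L) t = [ L ] , m^n>0 2 t , λ _ _ → here refl
results-cover (test Q a₀ a₁) zero = [] , z≤n , no-input
  where
  no-input : ∀ I → numTests (test Q a₀ a₁) I ≤ 0 → result (test Q a₀ a₁) I ∈ []
  no-input I _  with testAnswer Q I
  no-input I () | false
  no-input I () | true
results-cover (test Q a₀ a₁) (suc t) with results-cover a₀ t | results-cover a₁ t
... | Ls₀ , ∣Ls₀∣≤2^t , cover₀ | Ls₁ , ∣Ls₁∣≤2^t , cover₁ = Ls₀ ++ Ls₁ , ∣Ls∣≤2^[1+t] , cover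
  where
  ∣Ls∣≤2^[1+t] : length (Ls₀ ++ Ls₁) ≤ 2 ^ suc t
  ∣Ls∣≤2^[1+t] = ≤-trans (≤-reflexive (length-++ Ls₀))
    (≤-trans (+-mono-≤ ∣Ls₀∣≤2^t ∣Ls₁∣≤2^t) (≤-reflexive (cong (2 ^ t +_) (sym (+-identityʳ (2 ^ t))))))
  cover : ∀ I → numTests (test Q a₀ a₁) I ≤ suc t → result (test Q a₀ a₁) I ∈ Ls₀ ++ Ls₁
  cover I _ with testAnswer Q I
  cover I (s≤s ≤t) | false = ∈-++⁺ˡ (cover₀ I ≤t)
  cover I (s≤s ≤t) | true  = ∈-++⁺ʳ Ls₀ (cover₁ I ≤t)

Finds : ℕ → ℕ → Alg n → Set
Finds ℓ d A = ∀ I → ∣ I ∣ ≡ d → result A I ⊆ I × ∣ result A I ∣ ≡ ℓ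

TestsAtMost : ℕ → ℕ → Alg n → Set
TestsAtMost d t A = ∀ I → ∣ I ∣ ≡ d → numTests A I ≤ t

counting-bound : ∀ {ℓ d t} (A : Alg n) → ℓ ≤ d → d ≤ n → Finds ℓ d A → TestsAtMost d t A →
  n ^ ℓ ≤ 2 ^ t * d ^ ℓ
counting-bound {n} {ℓ} {d} {t} A ℓ≤d d≤n finds fast with results-cover A t
... | Ls , ∣Ls∣≤2^t , cover =
  *-cancelʳ-≤ (n ^ ℓ) (2 ^ t * d ^ ℓ) K {{>-nonZero (0<nCk (∸-monoˡ-≤ ℓ d≤n))}} (begin
    n ^ ℓ * K                     ≤⟨ n^l*[n∸l]C[d∸l]≤d^l*nCd ℓ≤d d≤n ⟩
    d ^ ℓ * (n C d)               ≡⟨ cong (d ^ ℓ *_) (length-subsets n d) ⟨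
    d ^ ℓ * length (subsets n d)  ≤⟨ *-monoʳ-≤ (d ^ ℓ) (length≤length*fibre _⊆?_ (subsets n d) Lsℓ covered fibres) ⟩
    d ^ ℓ * (length Lsℓ * K)      ≤⟨ *-monoʳ-≤ (d ^ ℓ) (*-monoˡ-≤ K (≤-trans (length-filter sized? Ls) ∣Ls∣≤2^t)) ⟩
    d ^ ℓ * (2 ^ t * K)           ≡⟨ *-assoc (d ^ ℓ) (2 ^ t) K ⟨
    d ^ ℓ * 2 ^ t * K             ≡⟨ cong (_* K) (*-comm (d ^ ℓ) (2 ^ t)) ⟩
    2 ^ t * d ^ ℓ * K             ∎)
  where
  open ≤-Reasoning
  K = (n ∸ ℓ) C (d ∸ ℓ)
  sized? = λ (L : Subset n) → ∣ L ∣ ≟ ℓ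
  Lsℓ = filter sized? Ls
  covered-by : ∀ {I} → ∣ I ∣ ≡ d → Any (_⊆ I) Lsℓ
  covered-by {I} ∣I∣≡d with finds I ∣I∣≡d
  ... | result⊆I , ∣result∣≡ℓ = lose (∈-filter⁺ sized? (cover I (fast I ∣I∣≡d)) ∣result∣≡ℓ) result⊆I
  covered : All (λ I → Any (_⊆ I) Lsℓ) (subsets n d)
  covered = All.map covered-by (subsets-sizes n d)
  fibres : All (λ L → length (filter (L ⊆?_) (subsets n d)) ≤ K) Lsℓ
  fibres = All.map (λ {L} ∣L∣≡ℓ → subst (λ m → length (filter (L ⊆?_) (subsets n d)) ≤ (n ∸ m) C (d ∸ m))
    ∣L∣≡ℓ (length-filter-⊆?-subsets d L)) (all-filter sized? Ls)

hitting-bound : ∀ {ℓ d t} (A : Alg n) → 1 ≤ ℓ → 2 * d ≤ n → Finds ℓ d A → TestsAtMost d t A →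
  n ≤ 2 ^ suc t
hitting-bound {n} {ℓ} {d} {t} A 1≤ℓ 2d≤n finds fast with n ≤? 2 ^ suc t
... | yes n≤2^[1+t] = n≤2^[1+t]
... | no n≰2^[1+t] with results-cover A t
... | Ls , ∣Ls∣≤2^t , cover with avoiding-subset d Ls (2*m≤o⇒2*n≤o⇒m+n≤o {d} {length Ls} 2d≤n 2∣Ls∣≤n)
  where
  2∣Ls∣≤n : 2 * length Ls ≤ n
  2∣Ls∣≤n = ≤-trans (*-monoʳ-≤ 2 ∣Ls∣≤2^t) (<⇒≤ (≰⇒> n≰2^[1+t]))
... | I , ∣I∣≡d , avoids with finds I ∣I∣≡d
... | result⊆I , ∣result∣≡ℓ =
  contradiction (trans (sym (Empty⇒∣p∣≡0 result-empty)) ∣result∣≡ℓ) (<⇒≢ 1≤ℓ)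
  where
  result-empty : Empty (result A I)
  result-empty = All.lookup avoids (cover I (fast I ∣I∣≡d)) result⊆I

theorem2 : (n ℓ d : ℕ) → 1 ≤ ℓ → ℓ ≤ d → 2 * d ≤ n →
    (A : Alg n) →
    ((I : Subset n) → ∣ I ∣ ≡ d → (result A I ⊆ I) × (∣ result A I ∣ ≡ ℓ)) →
    Σ (Subset n) (λ I → (∣ I ∣ ≡ d) ×
      ((n ^ ℓ ≤ 2 ^ numTests A I * d ^ ℓ) × (n ≤ 2 ^ suc (numTests A I))))
theorem2 n ℓ d 1≤ℓ ℓ≤d 2d≤n A finds with worst-case d (numTests A) (m+n≤o⇒m≤o d 2d≤n)
... | I , ∣I∣≡d , worst =
  I , ∣I∣≡d , counting-bound A ℓ≤d (m+n≤o⇒m≤o d 2d≤n) finds worst , hitting-bound A 1≤ℓ 2d≤n finds worst
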